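{- Let $I$ be an independent set of a graph $G$ and let $F=(\iota,\tau)$ be a $k$-flip on $V(G)$. Then there exists a $2k$-flip $F'$ on $V(G)$ such that $G\oplus F'$ is obtained from $G\oplus F$ by removing all the edges between vertices of $I$.
   Context: Graphs are finite and simple; adjacency $E_G(u,v)\in\mathrm{GF}(2)$. A $k$-flip on $V$ is $F=(\iota,\tau)$ with $\iota:V\to[k]$ and $\tau:[k]\times[k]\to\mathrm{GF}(2)$ symmetric; $G\oplus F$ has vertex set $V(G)$ and $E_{G\oplus F}(x,y)=E_G(x,y)+\tau(\iota(x),\iota(y))$ for distinct $x,y$. -}

module Defs where

open import Data.Nat using (ℕ; _*_)
open import Data.Fin using (Fin)
open import Data.Bool using (Bool; true; false; _xor_; _∧_; not)
open import Relation.Binary.PropositionalEquality using (_≡_; _≢_)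

-- GF(2) is represented by Bool with addition _xor_.

record Graph (n : ℕ) : Set where
  field
    E     : Fin n → Fin n → Bool
    sym   : ∀ x y → E x y ≡ E y x
    irrefl : ∀ x → E x x ≡ false
open Graph public

record Flip (k n : ℕ) : Set where
  field
    ι    : Fin n → Fin k
    τ    : Fin k → Fin k → Bool
    τsym : ∀ a b → τ a b ≡ τ b a
open Flip public

-- Adjacency of G ⊕ F on distinct vertices x, y.
flipE : ∀ {n k} → Graph n → Flip k n → Fin n → Fin n → Bool
flipE G F x y = E G x y xor τ F (ι F x) (ι F y)

Subset : ℕ → Set
Subset n = Fin n → Bool

Independent : ∀ {n} → Graph n → Subset n → Set
Independent G I = ∀ x y → I x ≡ true → I y ≡ true → E G x y ≡ false

removeInside : ∀ {n} → Subset n → (Fin n → Fin n → Bool) → Fin n → Fin n → Bool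
removeInside I A x y = not (I x ∧ I y) ∧ A x y

{-# OPTIONS --safe #-}
-- Refine the classes of F by membership in I, giving 2k classes (p , a), and
-- flip between (p , a) and (q , b) iff not (p ∧ q) ∧ τ a b: this flips exactly
-- the pairs F flips, except those inside I.  As I is independent in G, every
-- pair inside I is then a non-edge of G ⊕ F', while outside I nothing changed.
module Submission where

open import Defs hiding (sym)
open import Data.Nat using (ℕ; _*_)
open import Data.Fin using (Fin; combine; quotient; remainder)
open import Data.Fin.Patterns using (0F; 1F)
open import Data.Fin.Properties using (remQuot-combine)
open import Data.Bool using (Bool; true; false; _xor_; _∧_; not)
open import Data.Bool.Properties using (∧-distribˡ-xor)
open import Data.Product using (Σ; _,_; proj₁; proj₂)
open import Relation.Binary.PropositionalEquality
  using (_≡_; _≢_; refl; sym; cong; cong₂; module ≡-Reasoning)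

private
  variable
    m k n : ℕ

flipped : Flip k n → Fin n → Fin n → Bool
flipped F x y = τ F (ι F x) (ι F y)

quotient-combine : (i : Fin m) (j : Fin k) → quotient k (combine i j) ≡ i
quotient-combine i j = cong proj₁ (remQuot-combine i j)

remainder-combine : (i : Fin m) (j : Fin k) → remainder {m} k (combine i j) ≡ j
remainder-combine i j = cong proj₂ (remQuot-combine i j)

_∧ᶠ_ : Flip m n → Flip k n → Flip (m * k) n
_∧ᶠ_ {m = m} {k = k} F₁ F₂ = record
  { ι    = λ x → combine (ι F₁ x) (ι F₂ x)
  ; τ    = λ i j → τ F₁ (quotient k i) (quotient k j) ∧ τ F₂ (rem i) (rem j)
  ; τsym = λ i j → cong₂ _∧_ (τsym F₁ (quotient k i) (quotient k j)) (τsym F₂ (rem i) (rem j))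
  }
  where
  rem : Fin (m * k) → Fin k
  rem = remainder {m} k

flipped-∧ᶠ : (F₁ : Flip m n) (F₂ : Flip k n) (x y : Fin n) →
             flipped (F₁ ∧ᶠ F₂) x y ≡ flipped F₁ x y ∧ flipped F₂ x y
flipped-∧ᶠ F₁ F₂ x y =
  cong₂ _∧_ (cong₂ (τ F₁) (quotient-combine (ι F₁ x) (ι F₂ x)) (quotient-combine (ι F₁ y) (ι F₂ y)))
            (cong₂ (τ F₂) (remainder-combine (ι F₁ x) (ι F₂ x)) (remainder-combine (ι F₁ y) (ι F₂ y)))

notBothIn : Subset n → Flip 2 n
notBothIn I = record { ι = tag ; τ = notBoth ; τsym = notBoth-sym }
  where
  tag : Fin _ → Fin 2
  tag x with I x
  ... | false = 0F
  ... | true  = 1F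

  notBoth : Fin 2 → Fin 2 → Bool
  notBoth 1F 1F = false
  notBoth _  _  = true

  notBoth-sym : ∀ a b → notBoth a b ≡ notBoth b a
  notBoth-sym 0F 0F = refl
  notBoth-sym 0F 1F = refl
  notBoth-sym 1F 0F = refl
  notBoth-sym 1F 1F = refl

flipped-notBothIn : (I : Subset n) (x y : Fin n) →
                    flipped (notBothIn I) x y ≡ not (I x ∧ I y)
flipped-notBothIn I x y with I x | I y
... | false | false = refl
... | false | true  = refl
... | true  | false = refl
... | true  | true  = refl

removeInside-independent : (G : Graph n) (I : Subset n) → Independent G I →
                           ∀ x y → removeInside I (E G) x y ≡ E G x y
removeInside-independent G I ind x y with I x in Ix | I y in Iy
... | false | _     = refl
... | true  | false = refl
... | true  | true  = sym (ind x y Ix Iy)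

lemma8 : ∀ {n} (k : ℕ) (G : Graph n) (I : Subset n) → Independent G I → (F : Flip k n)
         → Σ (Flip (2 * k) n) (λ F' → ∀ (x y : Fin n) → x ≢ y
             → flipE G F' x y ≡ removeInside I (flipE G F) x y)
lemma8 k G I ind F = notBothIn I ∧ᶠ F , agree
  where
  open ≡-Reasoning
  agree : ∀ x y → x ≢ y → flipE G (notBothIn I ∧ᶠ F) x y ≡ removeInside I (flipE G F) x y
  -- flipE is defined on all pairs.
  agree x y _ = begin
    E G x y xor flipped (notBothIn I ∧ᶠ F) x y
      ≡⟨ cong (E G x y xor_) (flipped-∧ᶠ (notBothIn I) F x y) ⟩
    E G x y xor (flipped (notBothIn I) x y ∧ flipped F x y)
      ≡⟨ cong (λ b → E G x y xor (b ∧ flipped F x y)) (flipped-notBothIn I x y) ⟩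
    E G x y xor (not (I x ∧ I y) ∧ flipped F x y)
      ≡⟨ cong (_xor (not (I x ∧ I y) ∧ flipped F x y))
              (removeInside-independent G I ind x y) ⟨
    (not (I x ∧ I y) ∧ E G x y) xor (not (I x ∧ I y) ∧ flipped F x y)
      ≡⟨ ∧-distribˡ-xor (not (I x ∧ I y)) (E G x y) (flipped F x y) ⟨
    removeInside I (flipE G F) x y
      ∎
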